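{- Let $k\ge 2$ and let $a_1,a_2,\dots,a_k$ be positive integers with $\gcd(a_1,a_2,\dots,a_k)=1$. Then there exists an integer $G$ such that every integer $n>G$ can be written as $$n=a_1x_1+a_2x_2+\cdots+a_kx_k,\qquad x_1,\dots,x_k\in\mathbb{Z}_{\ge 0},\ \gcd(x_1,\dots,x_k)=1.$$ In other words, the least such integer $G_{a_1,\dots,a_k}$ is finite (well defined).
   Context: $G_{a_1,\dots,a_k}$ denotes the least integer such that every integer $n>G_{a_1,\dots,a_k}$ has a representation $n=a_1x_1+\cdots+a_kx_k$ with all $x_i$ nonnegative integers and $\gcd(x_1,\dots,x_k)=1$. -}

module Defs where

open import Data.Nat using (ℕ; zero; suc; _+_; _*_)
open import Data.Nat.GCD using (gcd)
open import Data.Vec using (Vec; []; _∷_; foldr; zipWith)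
import Data.Vec as Vec

gcdVec : ∀ {k} → Vec ℕ k → ℕ
gcdVec = foldr _ gcd 0

dot : ∀ {k} → Vec ℕ k → Vec ℕ k → ℕ
dot a x = Vec.sum (zipWith _*_ a x)

{-# OPTIONS --safe #-}
module Submission where

-- Write a = (a₁, a′) and g = gcd a′, so gcd(a₁, g) = 1. Every large multiple g y is a′ · x′ for some
-- x′ ≥ 0, and then gcd x′ divides y; so it suffices to write each large n as a₁ x + g y with
-- gcd(x, y) = 1 and y large. Fix one solution (x₀, y₀) with x₀ < g; the others are
-- (x₀ + g t, y₀ − a₁ t), and a prime p ∣ n divides both coordinates for at most one class of t mod p.
-- Sieving these classes prime by prime yields a good t below any modulus that the primes of n divide.
-- With K = 4 a₁ g: if n has a prime factor q ≥ K, sieving n/q and then q gives t < 2n/q ≤ n/(2 a₁ g);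
-- otherwise every prime factor of n divides K!, giving t < K!. In both cases y₀ − a₁ t stays large.

open import Defs
open import Data.Nat using (ℕ; _≤_; _*_; NonZero)
open import Data.Integer using (ℤ; +_; _>_)
open import Data.Vec using (Vec)
open import Data.Vec.Relation.Unary.All using (All)
open import Data.Product using (Σ; _×_)
open import Relation.Binary.PropositionalEquality using (_≡_)

open import Data.Nat.Base hiding (_>_)
open import Data.Nat.Properties
open import Data.Nat.Divisibility
open import Data.Nat.DivMod using (_%_; _/_; m%n<n; m≡m%n+[m/n]*n)
open import Data.Nat.GCD
open import Data.Nat.Primality
open import Data.Nat.Primality.Factorisation
  using (factorise; module PrimeFactorisation; factorisationHasAllPrimeFactors)
open import Data.Nat.ListAction using (product)
open import Data.Nat.ListAction.Properties using (∈⇒∣product)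
open import Data.Nat.Tactic.RingSolver using (solve-∀)
open import Data.Integer.Base using (+<+)
open import Data.List.Base using ([]; _∷_)
import Data.List.Relation.Unary.All as List
open import Data.List.Relation.Unary.Any using (any?)
open import Data.List.Membership.Propositional using (find; lose)
open import Data.Vec.Base using ([]; _∷_)
open import Data.Vec.Relation.Unary.All as Vec using ([]; _∷_)
open import Data.Product using (∃-syntax; _,_; proj₁; proj₂)
open import Data.Sum.Base using (_⊎_; inj₁; inj₂)
open import Relation.Nullary using (¬_; Dec; yes; no; contradiction)
open import Relation.Nullary.Decidable using (_×-dec_)
open import Relation.Binary.PropositionalEquality
  using (refl; sym; trans; cong; subst; module ≡-Reasoning)

prime∤1 : ∀ {p} → Prime p → ¬ p ∣ 1
prime∤1 p-prime p∣1 = ¬prime[1] (subst Prime (∣1⇒≡1 p∣1) p-prime)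

prime∤p∸1 : ∀ {p} → Prime p → ¬ p ∣ p ∸ 1
prime∤p∸1 {suc (suc k)} _ p∣p∸1 = 1+n≰n (∣⇒≤ p∣p∸1)

prime∣prime⇒≡ : ∀ {p q} → Prime p → Prime q → q ∣ p → q ≡ p
prime∣prime⇒≡ p-prime q-prime q∣p with prime⇒irreducible p-prime q∣p
... | inj₁ refl = contradiction ∣-refl (prime∤1 q-prime)
... | inj₂ q≡p  = q≡p

m≤n⇒m∣n! : ∀ {m n} .{{_ : NonZero m}} → m ≤ n → m ∣ n !
m≤n⇒m∣n! {suc m} m≤n = ∣-trans (m∣m*n (m !)) (m≤n⇒m!∣n! m≤n)

no-prime-divisor⇒≡1 : ∀ d .{{_ : NonZero d}} → (∀ {p} → Prime p → ¬ p ∣ d) → d ≡ 1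
no-prime-divisor⇒≡1 d no-prime with factors (factorise d)
                                 | isFactorisation (factorise d)
                                 | factorsPrime (factorise d)
  where open PrimeFactorisation
... | []     | d≡1   | _                = d≡1
... | p ∷ ps | d≡p*P | p-prime List.∷ _ =
  contradiction (subst (p ∣_) (sym d≡p*P) (m∣m*n (product ps))) (no-prime p-prime)

gcd≡1-∣ʳ : ∀ {m n d} → d ∣ n → gcd m n ≡ 1 → gcd m d ≡ 1
gcd≡1-∣ʳ {m} {n} {d} d∣n gcd≡1 =
  ∣1⇒≡1 (subst (gcd m d ∣_) gcd≡1 (gcd-greatest (gcd[m,n]∣m m d) (∣-trans (gcd[m,n]∣n m d) d∣n)))

∣-dot : ∀ {k d e} (a x : Vec ℕ k) → All (d ∣_) a → All (e ∣_) x → d * e ∣ dot a x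
∣-dot []       []       []           []           = _ ∣0
∣-dot (a ∷ as) (x ∷ xs) (d∣a ∷ d∣as) (e∣x ∷ e∣xs) =
  ∣m∣n⇒∣m+n (*-pres-∣ d∣a e∣x) (∣-dot as xs d∣as e∣xs)

gcdVec∣ : ∀ {k} (v : Vec ℕ k) → All (gcdVec v ∣_) v
gcdVec∣ []      = []
gcdVec∣ (h ∷ t) =
  gcd[m,n]∣m h (gcdVec t) ∷ Vec.map (∣-trans (gcd[m,n]∣n h (gcdVec t))) (gcdVec∣ t)

gcdVec≢0 : ∀ {k} (c : Vec ℕ (suc k)) → All NonZero c → NonZero (gcdVec c)
gcdVec≢0 (c ∷ cs) (c≢0 ∷ _) =
  ≢-nonZero (λ g≡0 → ≢-nonZero⁻¹ c {{c≢0}} (gcd[m,n]≡0⇒m≡0 g≡0))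

dot≡gcdVec*y⇒gcdVec∣y : ∀ {k} (c x : Vec ℕ k) {y} .{{_ : NonZero (gcdVec c)}} →
                 dot c x ≡ gcdVec c * y → gcdVec x ∣ y
dot≡gcdVec*y⇒gcdVec∣y c x {y} cx≡gy =
  *-cancelˡ-∣ (gcdVec c) (subst (gcdVec c * gcdVec x ∣_) cx≡gy (∣-dot c x (gcdVec∣ c) (gcdVec∣ x)))

congruence⇒representation : ∀ A B .{{_ : NonZero B}} n w e v →
                            A * w + B * e ≡ n + B * v → A * B ≤ n →
                            ∃[ x ] ∃[ y ] x < B × n ≡ A * x + B * y
congruence⇒representation A B n w e v Aw≡n AB≤n = x , quotient B∣r , m%n<n w B , n≡Ax+By
  where
  open ≡-Reasoning
  x = w % B
  r = n ∸ A * x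
  n≡Ax+r : n ≡ A * x + r
  n≡Ax+r = sym (m+[n∸m]≡n (≤-trans (*-monoʳ-≤ A (<⇒≤ (m%n<n w B))) AB≤n))
  regroup : ∀ A x q B e → A * x + B * (A * q + e) ≡ A * (x + q * B) + B * e
  regroup = solve-∀
  Bq≡r+Bv : B * (A * (w / B) + e) ≡ r + B * v
  Bq≡r+Bv = +-cancelˡ-≡ (A * x) _ _ (begin
    A * x + B * (A * (w / B) + e)   ≡⟨ regroup A x (w / B) B e ⟩
    A * (x + w / B * B) + B * e     ≡⟨ cong (λ z → A * z + B * e) (m≡m%n+[m/n]*n w B) ⟨
    A * w + B * e                   ≡⟨ Aw≡n ⟩
    n + B * v                       ≡⟨ cong (_+ B * v) n≡Ax+r ⟩
    A * x + r + B * v               ≡⟨ +-assoc (A * x) r (B * v) ⟩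
    A * x + (r + B * v)             ∎)
  B∣r : B ∣ r
  B∣r = ∣m+n∣m⇒∣n (subst (B ∣_) (trans Bq≡r+Bv (+-comm r (B * v))) (m∣m*n _)) (m∣m*n v)
  n≡Ax+By : n ≡ A * x + B * quotient B∣r
  n≡Ax+By = trans n≡Ax+r (cong (_+_ (A * x)) (trans (m∣n⇒n≡quotient*m B∣r) (*-comm _ B)))

gcd∣⇒congruence : ∀ A b n → gcd A (suc b) ∣ n →
                  ∃[ w ] ∃[ e ] ∃[ v ] A * w + suc b * e ≡ n + suc b * v
gcd∣⇒congruence A b n (divides k refl) with Bézout.identity (gcd-GCD A (suc b))
... | Bézout.+- u v g+vB≡uA = u * k , 0 , v * k , (begin
  A * (u * k) + suc b * 0              ≡⟨ lhs A u k b ⟩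
  k * (u * A)                          ≡⟨ cong (k *_) g+vB≡uA ⟨
  k * (g + v * suc b)                  ≡⟨ rhs k g v b ⟩
  k * g + suc b * (v * k)              ∎)
  where
  open ≡-Reasoning
  g = gcd A (suc b)
  lhs : ∀ A u k b → A * (u * k) + suc b * 0 ≡ k * (u * A)
  lhs = solve-∀
  rhs : ∀ k g v b → k * (g + v * suc b) ≡ k * g + suc b * (v * k)
  rhs = solve-∀
-- Here A u ≡ −g (mod B); multiplying by b ≡ −1 (mod B) turns it into A u b ≡ g.
... | Bézout.-+ u v g+uA≡vB = u * k * b , k * g , v * k * b , (begin
  A * (u * k * b) + suc b * (k * g)    ≡⟨ lhs A u k b g ⟩
  k * g + b * k * (g + u * A)          ≡⟨ cong (λ z → k * g + b * k * z) g+uA≡vB ⟩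
  k * g + b * k * (v * suc b)          ≡⟨ rhs k g b v ⟩
  k * g + suc b * (v * k * b)          ∎)
  where
  open ≡-Reasoning
  g = gcd A (suc b)
  lhs : ∀ A u k b g → A * (u * k * b) + suc b * (k * g) ≡ k * g + b * k * (g + u * A)
  lhs = solve-∀
  rhs : ∀ k g b v → k * g + b * k * (v * suc b) ≡ k * g + suc b * (v * k * b)
  rhs = solve-∀

gcd∣⇒representation : ∀ A B .{{_ : NonZero B}} n → gcd A B ∣ n → A * B ≤ n →
                      ∃[ x ] ∃[ y ] x < B × n ≡ A * x + B * y
gcd∣⇒representation A B@(suc b) n g∣n AB≤n with gcd∣⇒congruence A b n g∣n
... | w , e , v , Aw≡n = congruence⇒representation A B n w e v Aw≡n AB≤n

gcdVec-multiples-representable : ∀ {k} (c : Vec ℕ (suc k)) → All NonZero c →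
                                 ∃[ F ] ∀ y → F ≤ y → ∃[ x ] dot c x ≡ gcdVec c * y
gcdVec-multiples-representable (c ∷ []) _ =
  0 , λ y _ → y ∷ [] , trans (+-identityʳ (c * y)) (cong (_* y) (sym (gcd-identityʳ c)))
gcdVec-multiples-representable (c ∷ cs@(_ ∷ _)) c∷cs≢0@(_ ∷ cs≢0)
  with gcdVec-multiples-representable cs cs≢0
... | F , cs-represents = c * g + g * F , represents
  where
  g = gcdVec cs
  instance
    g≢0 : NonZero g
    g≢0 = gcdVec≢0 cs cs≢0
    h≢0 : NonZero (gcd c g)
    h≢0 = gcdVec≢0 (c ∷ cs) c∷cs≢0
  represents : ∀ y → c * g + g * F ≤ y → ∃[ x ] dot (c ∷ cs) x ≡ gcd c g * y
  represents y bound with gcd∣⇒representation c g (gcd c g * y) (m∣m*n y)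
                            (≤-trans (m≤m+n (c * g) (g * F)) (≤-trans bound (m≤n*m y (gcd c g))))
  ... | x₁ , v , x₁<g , hy≡ with cs-represents v F≤v
    where
    F≤v : F ≤ v
    F≤v = *-cancelˡ-≤ g (+-cancelˡ-≤ (c * g) (g * F) (g * v) (begin
      c * g + g * F     ≤⟨ bound ⟩
      y                 ≤⟨ m≤n*m y (gcd c g) ⟩
      gcd c g * y       ≡⟨ hy≡ ⟩
      c * x₁ + g * v    ≤⟨ +-monoˡ-≤ (g * v) (*-monoʳ-≤ c (<⇒≤ x₁<g)) ⟩
      c * g + g * v     ∎))
      where open ≤-Reasoning
  ... | xs , xs-represents = x₁ ∷ xs , trans (cong (_+_ (c * x₁)) xs-represents) (sym hy≡)

module _ (K n : ℕ) .{{_ : NonZero n}} where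
  open PrimeFactorisation (factorise n)

  large-prime-divisor? : (∃[ q ] Prime q × K ≤ q × q ∣ n) ⊎ (∀ {p} → Prime p → p ∣ n → p < K)
  large-prime-divisor? with any? (K ≤?_) factors
  ... | yes large = let q , q∈factors , K≤q = find large in
    inj₁ (q , List.lookup factorsPrime q∈factors , K≤q ,
           subst (q ∣_) (sym isFactorisation) (∈⇒∣product q∈factors))
  ... | no ¬large = inj₂ λ {p} p-prime p∣n →
    ≰⇒> (λ K≤p → ¬large (lose (factorisationHasAllPrimeFactors p-prime
                                  (subst (p ∣_) isFactorisation p∣n) factorsPrime) K≤p))

module ResidueSieve
  (Bad : ℕ → ℕ → Set)
  (bad? : ∀ p t → Dec (Bad p t))
  (bad-periodic : ∀ {q D t} → q ∣ D → Bad q (t + D) → Bad q t)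
  (bad-unique : ∀ {p t D} → Prime p → Bad p t → Bad p (t + D) → p ∣ D)
  where

  Avoids : ℕ → ℕ → Set
  Avoids m t = ∀ {p} → Prime p → p ∣ m → ¬ Bad p t

  avoids-* : ∀ {p m t} → Prime p → Avoids m t → ∃[ u ] u ≤ t + m × Avoids (p * m) u
  avoids-* {p} {m} {t} p-prime avoids with bad? p t
  ... | no ¬bad = t , m≤m+n t m , avoids′
    where
    avoids′ : Avoids (p * m) t
    avoids′ q-prime q∣pm with euclidsLemma p m q-prime q∣pm
    ... | inj₁ q∣p with refl ← prime∣prime⇒≡ p-prime q-prime q∣p = ¬bad
    ... | inj₂ q∣m = avoids q-prime q∣m
  ... | yes bad = t + m , ≤-refl , avoids′
    where
    avoids′ : Avoids (p * m) (t + m)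
    avoids′ q-prime q∣pm with euclidsLemma p m q-prime q∣pm
    ... | inj₁ q∣p with refl ← prime∣prime⇒≡ p-prime q-prime q∣p =
      λ bad′ → avoids p-prime (bad-unique p-prime bad bad′) bad
    ... | inj₂ q∣m = λ bad′ → avoids q-prime q∣m (bad-periodic q∣m bad′)

  avoids-product : ∀ {ps} → List.All Prime ps → ∃[ t ] t < product ps × Avoids (product ps) t
  avoids-product List.[] = 0 , z<s , λ p-prime p∣1 _ → prime∤1 p-prime p∣1
  avoids-product {p ∷ ps} (p-prime List.∷ ps-prime) with avoids-product ps-prime
  ... | t , t<P , avoids with avoids-* p-prime avoids
  ... | u , u≤t+P , avoids′ = u , u<pP , avoids′
    where
    open ≤-Reasoning
    P = product ps
    u<pP : u < p * P
    u<pP = begin-strict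
      u              ≤⟨ u≤t+P ⟩
      t + P          <⟨ +-monoˡ-< P t<P ⟩
      P + P          ≡⟨ cong (_+_ P) (+-identityʳ P) ⟨
      2 * P          ≤⟨ *-monoˡ-≤ P (nonTrivial⇒n>1 p {{prime⇒nonTrivial p-prime}}) ⟩
      p * P          ∎

  avoids-< : ∀ m .{{_ : NonZero m}} → ∃[ t ] t < m × Avoids m t
  avoids-< m =
    subst (λ m → ∃[ t ] t < m × Avoids m t) (sym isFactorisation) (avoids-product factorsPrime)
    where open PrimeFactorisation (factorise m)

  avoids-large-prime : ∀ {K q} n .{{_ : NonZero n}} → Prime q → K ≤ q → q ∣ n →
                       ∃[ t ] Avoids n t × t * K ≤ 2 * n
  avoids-large-prime {K} {q} n q-prime K≤q q∣n with avoids-< (quotient q∣n) {{quotient≢0 q∣n}}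
  ... | t , t<m , avoids with avoids-* q-prime avoids
  ... | u , u≤t+m , avoids′ = u , subst (λ n → Avoids n u) n≡qm avoids′ , uK≤2n
    where
    m = quotient q∣n
    n≡qm : q * m ≡ n
    n≡qm = trans (*-comm q m) (sym (m∣n⇒n≡quotient*m q∣n))
    regroup : ∀ m q → (m + m) * q ≡ 2 * (q * m)
    regroup = solve-∀
    uK≤2n : u * K ≤ 2 * n
    uK≤2n = begin
      u * K          ≤⟨ *-monoˡ-≤ K (≤-trans u≤t+m (+-monoˡ-≤ m (<⇒≤ t<m))) ⟩
      (m + m) * K    ≤⟨ *-monoʳ-≤ (m + m) K≤q ⟩
      (m + m) * q    ≡⟨ regroup m q ⟩
      2 * (q * m)    ≡⟨ cong (2 *_) n≡qm ⟩
      2 * n          ∎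
      where open ≤-Reasoning

  avoids-small-primes : ∀ K n → (∀ {p} → Prime p → p ∣ n → p < K) → ∃[ t ] Avoids n t × t < K !
  avoids-small-primes K n small with avoids-< (K !) {{K !≢0}}
  ... | t , t<K! , avoids = t , avoids′ , t<K!
    where
    avoids′ : Avoids n t
    avoids′ p-prime p∣n =
      avoids p-prime (m≤n⇒m∣n! {{prime⇒nonZero p-prime}} (<⇒≤ (small p-prime p∣n)))

  avoids-bounded : ∀ K n .{{_ : NonZero n}} → ∃[ t ] Avoids n t × (t * K ≤ 2 * n ⊎ t < K !)
  avoids-bounded K n with large-prime-divisor? K n
  ... | inj₁ (q , q-prime , K≤q , q∣n) with avoids-large-prime n q-prime K≤q q∣n
  ...   | t , avoids , tK≤2n = t , avoids , inj₁ tK≤2n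
  avoids-bounded K n | inj₂ small with avoids-small-primes K n small
  ...   | t , avoids , t<K! = t , avoids , inj₂ t<K!

linear-shift : ∀ a c t D → a + c * (t + D) ≡ (a + c * t) + c * D
linear-shift = solve-∀

∣-unshift : ∀ {d} a c t D → d ∣ c * D → d ∣ a + c * (t + D) → d ∣ a + c * t
∣-unshift {d} a c t D d∣cD d∣shifted =
  ∣m+n∣m⇒∣n (subst (d ∣_) (trans (linear-shift a c t D) (+-comm (a + c * t) (c * D))) d∣shifted)
            d∣cD

∣-shift-difference : ∀ {d} a c t D → d ∣ a + c * t → d ∣ a + c * (t + D) → d ∣ c * D
∣-shift-difference {d} a c t D d∣ d∣shifted =
  ∣m+n∣m⇒∣n (subst (d ∣_) (linear-shift a c t D) d∣shifted) d∣

module Shifts (A B : ℕ) (coprime : gcd A B ≡ 1) (x₀ y₀ : ℕ) where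

  -- p divides both coordinates of the shifted solution (x₀ + B t, y₀ − A t); the second is
  -- written as y₀ + A (p − 1) t, which is congruent to it mod p and needs no truncated subtraction.
  Bad : ℕ → ℕ → Set
  Bad p t = p ∣ x₀ + B * t × p ∣ y₀ + A * (p ∸ 1) * t

  bad? : ∀ p t → Dec (Bad p t)
  bad? p t = (p ∣? _) ×-dec (p ∣? _)

  bad-periodic : ∀ {q D t} → q ∣ D → Bad q (t + D) → Bad q t
  bad-periodic {q} {D} {t} q∣D (q∣x , q∣y) =
    ∣-unshift x₀ B t D (∣n⇒∣m*n B q∣D) q∣x ,
    ∣-unshift y₀ (A * (q ∸ 1)) t D (∣n⇒∣m*n (A * (q ∸ 1)) q∣D) q∣y

  bad-unique : ∀ {p t D} → Prime p → Bad p t → Bad p (t + D) → p ∣ D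
  bad-unique {p} {t} {D} p-prime (p∣x , p∣y) (p∣x′ , p∣y′)
    with euclidsLemma B D p-prime (∣-shift-difference x₀ B t D p∣x p∣x′)
       | euclidsLemma (A * (p ∸ 1)) D p-prime (∣-shift-difference y₀ (A * (p ∸ 1)) t D p∣y p∣y′)
  ... | inj₂ p∣D | _        = p∣D
  ... | inj₁ _   | inj₂ p∣D = p∣D
  ... | inj₁ p∣B | inj₁ p∣A[p∸1] with euclidsLemma A (p ∸ 1) p-prime p∣A[p∸1]
  ...   | inj₁ p∣A   = contradiction (subst (p ∣_) coprime (gcd-greatest p∣A p∣B)) (prime∤1 p-prime)
  ...   | inj₂ p∣p∸1 = contradiction p∣p∸1 (prime∤p∸1 p-prime)

  open ResidueSieve Bad bad? bad-periodic bad-unique public using (Avoids; avoids-bounded)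

  shifted-solution : ∀ {n F t} .{{_ : NonZero n}} → n ≡ A * x₀ + B * y₀ → A * t + F ≤ y₀ →
                     Avoids n t → ∃[ x ] ∃[ y ] n ≡ A * x + B * y × F ≤ y × gcd x y ≡ 1
  shifted-solution {n} {F} {t} n≡ At+F≤y₀ avoids with m≤n⇒∃[o]m+o≡n At+F≤y₀
  ... | w , At+F+w≡y₀ = x , y , n≡Ax+By , m≤m+n F w , no-prime-divisor⇒≡1 (gcd x y) no-common-prime
    where
    open ≡-Reasoning
    x = x₀ + B * t
    y = F + w
    regroup : ∀ A B x₀ t F w → A * x₀ + B * (A * t + F + w) ≡ A * (x₀ + B * t) + B * (F + w)
    regroup = solve-∀
    n≡Ax+By : n ≡ A * x + B * y
    n≡Ax+By = begin
      n                              ≡⟨ n≡ ⟩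
      A * x₀ + B * y₀                ≡⟨ cong (λ z → A * x₀ + B * z) At+F+w≡y₀ ⟨
      A * x₀ + B * (A * t + F + w)   ≡⟨ regroup A B x₀ t F w ⟩
      A * x + B * y                  ∎
    gcd∣n : gcd x y ∣ n
    gcd∣n = subst (gcd x y ∣_) (sym n≡Ax+By)
      (∣m∣n⇒∣m+n (∣n⇒∣m*n A (gcd[m,n]∣m x y)) (∣n⇒∣m*n B (gcd[m,n]∣n x y)))
    instance
      gcd≢0 : NonZero (gcd x y)
      gcd≢0 = ≢-nonZero (λ g≡0 → ≢-nonZero⁻¹ n (0∣⇒≡0 (subst (_∣ n) g≡0 gcd∣n)))
    y-shifted : ∀ p → y + suc p * (A * t) ≡ y₀ + A * p * t
    y-shifted p = trans (regroup′ A t F w p) (cong (λ z → z + A * p * t) At+F+w≡y₀)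
      where
      regroup′ : ∀ A t F w p → F + w + suc p * (A * t) ≡ A * t + F + w + A * p * t
      regroup′ = solve-∀
    no-common-prime : ∀ {p} → Prime p → ¬ p ∣ gcd x y
    no-common-prime {suc p} p-prime p∣g = avoids p-prime (∣-trans p∣g gcd∣n) (p∣x , p∣y₀-Apt)
      where
      p∣x = ∣-trans p∣g (gcd[m,n]∣m x y)
      p∣y₀-Apt = subst (suc p ∣_) (y-shifted p)
        (∣m∣n⇒∣m+n (∣-trans p∣g (gcd[m,n]∣n x y)) (m∣m*n (A * t)))

shift-bound : ∀ A B F {n x₀ y₀} t .{{_ : NonZero B}} → x₀ < B → n ≡ A * x₀ + B * y₀ →
             A * B * t + (B * F + A * B) ≤ n → A * t + F ≤ y₀
shift-bound A B F {n} {x₀} {y₀} t x₀<B n≡ bound =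
  *-cancelˡ-≤ B (+-cancelʳ-≤ (A * x₀) (B * (A * t + F)) (B * y₀) (begin
    B * (A * t + F) + A * x₀      ≤⟨ +-monoʳ-≤ (B * (A * t + F)) (*-monoʳ-≤ A (<⇒≤ x₀<B)) ⟩
    B * (A * t + F) + A * B       ≡⟨ regroup A B F t ⟩
    A * B * t + (B * F + A * B)   ≤⟨ bound ⟩
    n                             ≡⟨ n≡ ⟩
    A * x₀ + B * y₀               ≡⟨ +-comm (A * x₀) (B * y₀) ⟩
    B * y₀ + A * x₀               ∎))
  where
  open ≤-Reasoning
  regroup : ∀ A B F t → B * (A * t + F) + A * B ≡ A * B * t + (B * F + A * B)
  regroup = solve-∀

eventually-coprime-solution₂ : ∀ A B F .{{_ : NonZero A}} .{{_ : NonZero B}} → gcd A B ≡ 1 →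
                         ∃[ N ] ∀ n → N ≤ n →
                           ∃[ x ] ∃[ y ] n ≡ A * x + B * y × F ≤ y × gcd x y ≡ 1
eventually-coprime-solution₂ A B F coprime = A * B * K ! + 2 * S , represents
  where
  K = 4 * A * B
  S = B * F + A * B
  represents : ∀ n → A * B * K ! + 2 * S ≤ n →
               ∃[ x ] ∃[ y ] n ≡ A * x + B * y × F ≤ y × gcd x y ≡ 1
  represents n N≤n =
    from-representation (gcd∣⇒representation A B n (subst (_∣ n) (sym coprime) (1∣ n)) AB≤n)
    where
    2S≤n : 2 * S ≤ n
    2S≤n = ≤-trans (m≤n+m (2 * S) (A * B * K !)) N≤n
    AB≤n : A * B ≤ n
    AB≤n = ≤-trans (m≤n+m (A * B) (B * F)) (≤-trans (m≤n*m S 2) 2S≤n)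
    instance
      n≢0 : NonZero n
      n≢0 = >-nonZero (≤-trans (>-nonZero⁻¹ (A * B) {{m*n≢0 A B}}) AB≤n)
    fits : ∀ {t} → t * K ≤ 2 * n ⊎ t < K ! → A * B * t + S ≤ n
    fits {t} (inj₁ tK≤2n) = *-cancelˡ-≤ 2 (begin
      2 * (A * B * t + S)       ≡⟨ *-distribˡ-+ 2 (A * B * t) S ⟩
      2 * (A * B * t) + 2 * S   ≤⟨ +-mono-≤ 2ABt≤n 2S≤n ⟩
      n + n                     ≡⟨ cong (_+_ n) (+-identityʳ n) ⟨
      2 * n                     ∎)
      where
      open ≤-Reasoning
      regroup : ∀ A B t → t * (4 * A * B) ≡ 2 * (2 * (A * B * t))
      regroup = solve-∀
      2ABt≤n : 2 * (A * B * t) ≤ n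
      2ABt≤n = *-cancelˡ-≤ 2 (subst (_≤ 2 * n) (regroup A B t) tK≤2n)
    fits (inj₂ t<K!) = ≤-trans (+-mono-≤ (*-monoʳ-≤ (A * B) (<⇒≤ t<K!)) (m≤n*m S 2)) N≤n
    from-representation : ∃[ x₀ ] ∃[ y₀ ] x₀ < B × n ≡ A * x₀ + B * y₀ →
                          ∃[ x ] ∃[ y ] n ≡ A * x + B * y × F ≤ y × gcd x y ≡ 1
    from-representation (x₀ , y₀ , x₀<B , n≡) with Shifts.avoids-bounded A B coprime x₀ y₀ K n
    ... | t , avoids , t-small =
      Shifts.shifted-solution A B coprime x₀ y₀ n≡ (shift-bound A B F t x₀<B n≡ (fits t-small))
                            avoids

eventually-coprime-solution : ∀ {k} (a : Vec ℕ (suc (suc k))) → All NonZero a → gcdVec a ≡ 1 →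
                              ∃[ N ] ∀ n → N ≤ n → ∃[ x ] n ≡ dot a x × gcdVec x ≡ 1
eventually-coprime-solution (a ∷ as) (a≢0 ∷ as≢0) gcd≡1 = N , represents
  where
  g = gcdVec as
  instance
    g≢0 : NonZero g
    g≢0 = gcdVec≢0 as as≢0
  F = proj₁ (gcdVec-multiples-representable as as≢0)
  two-variable = eventually-coprime-solution₂ a g F {{a≢0}} gcd≡1
  N = proj₁ two-variable
  represents : ∀ n → N ≤ n → ∃[ x ] n ≡ dot (a ∷ as) x × gcdVec x ≡ 1
  represents n N≤n =
    let x , y , n≡ax+gy , F≤y , gcd[x,y]≡1 = proj₂ two-variable n N≤n
        xs , as·xs≡gy = proj₂ (gcdVec-multiples-representable as as≢0) y F≤y
    in x ∷ xs , trans n≡ax+gy (cong (_+_ (a * x)) (sym as·xs≡gy)) ,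
       gcd≡1-∣ʳ {x} {y} {gcdVec xs} (dot≡gcdVec*y⇒gcdVec∣y as xs as·xs≡gy) gcd[x,y]≡1

theorem1 : (k : ℕ) → 2 ≤ k → (a : Vec ℕ k) → All NonZero a → gcdVec a ≡ 1 →
    Σ ℤ (λ G → (n : ℤ) → n > G →
      Σ (Vec ℕ k) (λ x → (n ≡ + dot a x) × (gcdVec x ≡ 1)))
theorem1 1 (s≤s ())
theorem1 (suc (suc k)) _ a a≢0 gcd≡1 =
  let N , represents = eventually-coprime-solution a a≢0 gcd≡1 in
  + N , λ where
    (+ n) (+<+ N<n) → let x , n≡ax , gcd[x]≡1 = represents n (<⇒≤ N<n) in x , cong +_ n≡ax , gcd[x]≡1
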